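{- Let $F$ be a field, $\lambda\ge 0$ an integer, and $A_1,\dots,A_n$ $\lambda$-Vandermonde finite subsets of $F$. Let $f\in F[X_1,\dots,X_n]$ be a polynomial in which the degree of each variable $X_i$ is at most $\lambda$. Then \[\sum_{a\in A_1\times\dots\times A_n}f(a)=f(0)\,|A_1|\cdots|A_n|.\]
   Context: A finite non-empty subset $A\subseteq F$ is $\lambda$-Vandermonde (for $\lambda\in\{0,\dots,|A|\}$) if $\sum_{a\in A}a^r=0$ for all $1\le r\le\lambda$. -}

module Defs where

open import Level using (_⊔_) renaming (suc to lsuc)
open import Data.Nat using (ℕ; zero; suc; _≤_)
open import Data.Fin using (Fin; toℕ)
open import Data.Vec using (Vec; []; _∷_; replicate)
open import Data.List using (List; []; _∷_; length; foldr; map)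
open import Data.Product using (∃)
open import Relation.Nullary using (¬_)
open import Algebra.Bundles using (CommutativeRing; Semiring)
import Algebra.Definitions.RawSemiring as RS
import Data.List.Relation.Unary.Unique.Setoid as U

record Field c ℓ : Set (lsuc (c ⊔ ℓ)) where
  field
    commutativeRing : CommutativeRing c ℓ
  open CommutativeRing commutativeRing public
  field
    0≉1     : ¬ (0# ≈ 1#)
    inverse : ∀ x → ¬ (x ≈ 0#) → ∃ λ y → x * y ≈ 1#

module _ {c ℓ} (F : Field c ℓ) where
  open Field F
  open RS (Semiring.rawSemiring semiring) using (_^_; _×_)

  Σ-list : List Carrier → Carrier
  Σ-list = foldr _+_ 0#

  -- A finite subset of F, represented by a duplicate-free list of its elements
  -- (w.r.t. the field's equality).
  -- d-Vandermonde: non-empty, d ≤ |A|, and Σ_{a∈A} a^r = 0 for 1 ≤ r ≤ d.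
  record IsVandermonde (d : ℕ) (A : List Carrier) : Set (c ⊔ ℓ) where
    field
      distinct  : U.Unique setoid A
      nonEmpty  : 1 ≤ length A
      d≤size    : d ≤ length A
      powerSums : ∀ (r : ℕ) → 1 ≤ r → r ≤ d → Σ-list (map (λ a → a ^ r) A) ≈ 0#

  -- Polynomials in n variables over F in which each variable has degree ≤ d,
  -- in the recursive representation F[X₁..Xₙ₊₁] = F[X₂..Xₙ₊₁][X₁]:
  -- a polynomial in suc n variables is the list of its d+1 coefficients
  -- (in powers X₁^0, …, X₁^d), each a polynomial in the remaining n variables.
  Poly : (d n : ℕ) → Set c
  Poly d zero    = Carrier
  Poly d (suc n) = Vec (Poly d n) (suc d)

  evalCoeffs : ∀ {P : Set c} {m} → (P → Carrier) → Vec P m → ℕ → Carrier → Carrier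
  evalCoeffs ev []       k x = 0#
  evalCoeffs ev (p ∷ ps) k x = ev p * (x ^ k) + evalCoeffs ev ps (suc k) x

  eval : ∀ d n → Poly d n → Vec Carrier n → Carrier
  eval d zero    f []       = f
  eval d (suc n) f (x ∷ xs) = evalCoeffs (λ p → eval d n p xs) f 0 x

  sumOverProduct : ∀ {n} → Vec (List Carrier) n → (Vec Carrier n → Carrier) → Carrier
  sumOverProduct []       g = g []
  sumOverProduct (A ∷ As) g = Σ-list (map (λ a → sumOverProduct As (λ v → g (a ∷ v))) A)

  sizeProduct : ∀ {n} → Vec (List Carrier) n → Carrier
  sizeProduct []       = 1#
  sizeProduct (A ∷ As) = (length A × 1#) * sizeProduct As

  zeroVec : ∀ n → Vec Carrier n
  zeroVec n = replicate n 0#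

module Submission where

open import Defs
open import Data.Nat using (ℕ; zero; suc; _≤_; s≤s; z≤n) renaming (_+_ to _+ℕ_)
open import Data.Nat.Properties using (+-suc; m≤m+n; ≤-trans; ≤-refl; ≤-reflexive)
open import Data.Vec using (Vec; []; _∷_)
open import Data.List using (List; []; _∷_; length; map)
open import Data.Vec.Relation.Unary.All using (All; []; _∷_)
open import Algebra.Bundles using (Semiring)
import Algebra.Definitions.RawSemiring as RS
import Algebra.Properties.CommutativeSemigroup as CommSemigroupProperties
import Relation.Binary.PropositionalEquality as ≡
import Relation.Binary.Reasoning.Setoid as SetoidReasoning

-- Expand f in its first variable, f = Σ_k p_k(X₂,…,Xₙ) X₁^k.  Summing over the
-- last n − 1 coordinates first and using the induction hypothesis replaces each
-- p_k by the constant p_k(0)·|A₂|⋯|Aₙ|.  Summing then over a₁ ∈ A₁ produces the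
-- power sums Σ_{a∈A₁} a^k, which vanish for 1 ≤ k ≤ d by the Vandermonde
-- property, while k = 0 contributes |A₁|.

module _ {c ℓ} (F : Field c ℓ) where
  open Field F
  open RS (Semiring.rawSemiring semiring) using (_^_; _×_)
  open CommSemigroupProperties +-commutativeSemigroup using (interchange)
  open SetoidReasoning setoid

  Σ-map-cong : ∀ (A : List Carrier) {f g : Carrier → Carrier} →
               (∀ a → f a ≈ g a) → Σ-list F (map f A) ≈ Σ-list F (map g A)
  Σ-map-cong []      f≈g = refl
  Σ-map-cong (a ∷ A) f≈g = +-cong (f≈g a) (Σ-map-cong A f≈g)

  Σ-map-+ : ∀ (A : List Carrier) (f g : Carrier → Carrier) →
            Σ-list F (map (λ a → f a + g a) A) ≈ Σ-list F (map f A) + Σ-list F (map g A)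
  Σ-map-+ []      f g = sym (+-identityʳ 0#)
  Σ-map-+ (a ∷ A) f g = trans (+-congˡ (Σ-map-+ A f g)) (interchange (f a) (g a) _ _)

  Σ-map-*ˡ : ∀ (A : List Carrier) (k : Carrier) (f : Carrier → Carrier) →
             Σ-list F (map (λ a → k * f a) A) ≈ k * Σ-list F (map f A)
  Σ-map-*ˡ []      k f = sym (zeroʳ k)
  Σ-map-*ˡ (a ∷ A) k f = trans (+-congˡ (Σ-map-*ˡ A k f)) (sym (distribˡ k (f a) _))

  Σ-map-*ʳ : ∀ (A : List Carrier) (k : Carrier) (f : Carrier → Carrier) →
             Σ-list F (map (λ a → f a * k) A) ≈ Σ-list F (map f A) * k
  Σ-map-*ʳ A k f = begin
    Σ-list F (map (λ a → f a * k) A) ≈⟨ Σ-map-cong A (λ a → *-comm (f a) k) ⟩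
    Σ-list F (map (λ a → k * f a) A) ≈⟨ Σ-map-*ˡ A k f ⟩
    k * Σ-list F (map f A)           ≈⟨ *-comm k _ ⟩
    Σ-list F (map f A) * k           ∎

  Σ-map-0# : ∀ (A : List Carrier) → Σ-list F (map (λ _ → 0#) A) ≈ 0#
  Σ-map-0# []      = refl
  Σ-map-0# (a ∷ A) = trans (+-identityˡ _) (Σ-map-0# A)

  Σ-map-^0 : ∀ (A : List Carrier) → Σ-list F (map (λ a → a ^ 0) A) ≈ length A × 1#
  Σ-map-^0 []      = refl
  Σ-map-^0 (a ∷ A) = +-congˡ (Σ-map-^0 A)

  sumOverProduct-cong : ∀ {n} (As : Vec (List Carrier) n) {g h : Vec Carrier n → Carrier} →
                        (∀ v → g v ≈ h v) → sumOverProduct F As g ≈ sumOverProduct F As h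
  sumOverProduct-cong []       g≈h = g≈h []
  sumOverProduct-cong (A ∷ As) g≈h =
    Σ-map-cong A (λ a → sumOverProduct-cong As (λ v → g≈h (a ∷ v)))

  sumOverProduct-+ : ∀ {n} (As : Vec (List Carrier) n) (g h : Vec Carrier n → Carrier) →
                     sumOverProduct F As (λ v → g v + h v)
                       ≈ sumOverProduct F As g + sumOverProduct F As h
  sumOverProduct-+ []       g h = refl
  sumOverProduct-+ (A ∷ As) g h =
    trans (Σ-map-cong A (λ a → sumOverProduct-+ As _ _)) (Σ-map-+ A _ _)

  sumOverProduct-*ʳ : ∀ {n} (As : Vec (List Carrier) n) (g : Vec Carrier n → Carrier) k →
                      sumOverProduct F As (λ v → g v * k) ≈ sumOverProduct F As g * k
  sumOverProduct-*ʳ []       g k = refl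
  sumOverProduct-*ʳ (A ∷ As) g k =
    trans (Σ-map-cong A (λ a → sumOverProduct-*ʳ As _ k)) (Σ-map-*ʳ A k _)

  sumOverProduct-0# : ∀ {n} (As : Vec (List Carrier) n) → sumOverProduct F As (λ _ → 0#) ≈ 0#
  sumOverProduct-0# []       = refl
  sumOverProduct-0# (A ∷ As) = trans (Σ-map-cong A (λ _ → sumOverProduct-0# As)) (Σ-map-0# A)

  evalCoeffs-cong : ∀ {P : Set c} {m} {e e′ : P → Carrier} → (∀ p → e p ≈ e′ p) →
                    (ps : Vec P m) → ∀ k x → evalCoeffs F e ps k x ≈ evalCoeffs F e′ ps k x
  evalCoeffs-cong e≈e′ []       k x = refl
  evalCoeffs-cong e≈e′ (p ∷ ps) k x = +-cong (*-congʳ (e≈e′ p)) (evalCoeffs-cong e≈e′ ps (suc k) x)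

  evalCoeffs-suc-0# : ∀ {P : Set c} {m} (e : P → Carrier) (ps : Vec P m) k →
                      evalCoeffs F e ps (suc k) 0# ≈ 0#
  evalCoeffs-suc-0# e []       k = refl
  evalCoeffs-suc-0# e (p ∷ ps) k = begin
    e p * (0# * 0# ^ k) + evalCoeffs F e ps (suc (suc k)) 0#
      ≈⟨ +-cong (*-congˡ (zeroˡ _)) (evalCoeffs-suc-0# e ps (suc k)) ⟩
    e p * 0# + 0#
      ≈⟨ +-identityʳ _ ⟩
    e p * 0#
      ≈⟨ zeroʳ _ ⟩
    0# ∎

  sumOverProduct-evalCoeffs :
    ∀ {d n m} (As : Vec (List Carrier) n) (ps : Vec (Poly F d n) m) k x →
    sumOverProduct F As (λ v → evalCoeffs F (λ p → eval F d n p v) ps k x)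
      ≈ evalCoeffs F (λ p → sumOverProduct F As (eval F d n p)) ps k x
  sumOverProduct-evalCoeffs As []       k x = sumOverProduct-0# As
  sumOverProduct-evalCoeffs As (p ∷ ps) k x =
    trans (sumOverProduct-+ As _ _)
          (+-cong (sumOverProduct-*ʳ As _ _) (sumOverProduct-evalCoeffs As ps (suc k) x))

  -- The coefficients sit at the exponents suc j, …, j + m, all within 1 … d.
  Σ-evalCoeffs-vanishes :
    ∀ {d} (A : List Carrier) → IsVandermonde F d A →
    ∀ {P : Set c} {m} (e : P → Carrier) (ps : Vec P m) j → j +ℕ m ≤ d →
    Σ-list F (map (evalCoeffs F e ps (suc j)) A) ≈ 0#
  Σ-evalCoeffs-vanishes A vA e []                 j _ = Σ-map-0# A
  Σ-evalCoeffs-vanishes A vA e (_∷_ {m} p ps) j j+m≤d = begin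
    Σ-list F (map (λ a → e p * a ^ suc j + evalCoeffs F e ps (suc (suc j)) a) A)
      ≈⟨ Σ-map-+ A _ _ ⟩
    Σ-list F (map (λ a → e p * a ^ suc j) A) + Σ-list F (map (evalCoeffs F e ps (suc (suc j))) A)
      ≈⟨ +-cong (Σ-map-*ˡ A (e p) (_^ suc j)) (Σ-evalCoeffs-vanishes A vA e ps (suc j) sj+m≤d) ⟩
    e p * Σ-list F (map (_^ suc j) A) + 0#
      ≈⟨ +-congʳ (*-congˡ (IsVandermonde.powerSums vA (suc j) (s≤s z≤n) sj≤d)) ⟩
    e p * 0# + 0#
      ≈⟨ +-identityʳ _ ⟩
    e p * 0#
      ≈⟨ zeroʳ _ ⟩
    0# ∎
    where
    sj+m≤d : suc j +ℕ m ≤ _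
    sj+m≤d = ≤-trans (≤-reflexive (≡.sym (+-suc j m))) j+m≤d
    sj≤d : suc j ≤ _
    sj≤d = ≤-trans (m≤m+n (suc j) m) sj+m≤d

  sumOverProduct-eval : ∀ d n (As : Vec (List Carrier) n) → All (IsVandermonde F d) As →
                        (f : Poly F d n) →
                        sumOverProduct F As (eval F d n f) ≈ eval F d n f (zeroVec F n) * sizeProduct F As
  sumOverProduct-eval d zero    []       []         f        = sym (*-identityʳ f)
  sumOverProduct-eval d (suc n) (A ∷ As) (vA ∷ vAs) (p ∷ ps) = begin
    Σ-list F (map (λ a → sumOverProduct F As (λ v → evalCoeffs F (λ q → eval F d n q v) (p ∷ ps) 0 a)) A)
      ≈⟨ Σ-map-cong A (λ a → trans (sumOverProduct-evalCoeffs As (p ∷ ps) 0 a)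
                                   (evalCoeffs-cong (sumOverProduct-eval d n As vAs) (p ∷ ps) 0 a)) ⟩
    Σ-list F (map (λ a → E p * a ^ 0 + evalCoeffs F E ps 1 a) A)
      ≈⟨ Σ-map-+ A _ _ ⟩
    Σ-list F (map (λ a → E p * a ^ 0) A) + Σ-list F (map (evalCoeffs F E ps 1) A)
      ≈⟨ +-cong (trans (Σ-map-*ˡ A (E p) (_^ 0)) (*-congˡ (Σ-map-^0 A)))
                (Σ-evalCoeffs-vanishes A vA E ps 0 ≤-refl) ⟩
    (E₀ p * S) * N + 0#
      ≈⟨ +-identityʳ _ ⟩
    (E₀ p * S) * N
      ≈⟨ trans (*-assoc _ _ _) (*-congˡ (*-comm S N)) ⟩
    E₀ p * (N * S)
      ≈⟨ *-congʳ (sym (trans (+-cong (*-identityʳ _) (evalCoeffs-suc-0# E₀ ps 0)) (+-identityʳ _))) ⟩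
    (E₀ p * 1# + evalCoeffs F E₀ ps 1 0#) * (N * S) ∎
    where
    S = sizeProduct F As
    N = length A × 1#
    E₀ = λ q → eval F d n q (zeroVec F n)
    E = λ q → E₀ q * S

theorem5p4 : ∀ {c ℓ} (F : Field c ℓ) (d n : ℕ)
    (As : Vec (List (Field.Carrier F)) n) →
    All (IsVandermonde F d) As →
    (f : Poly F d n) →
    Field._≈_ F (sumOverProduct F As (eval F d n f))
    (Field._*_ F (eval F d n f (zeroVec F n)) (sizeProduct F As))
theorem5p4 F = sumOverProduct-eval F
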